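{- Let $V$ be a finite set with $|V|\ge 4$ and let $R=R(a_1,a_2,a_3)=\{<_1,<_2,<_3\}$ be a standard representation of $V$. Let $b=\max_{<_1}(V\setminus\{a_1\})$, let $V'=V\setminus\{b\}$, let $<_i'$ be the restriction of $<_i$ to $V'$ for $i=1,2,3$, and let $R'=\{<_1',<_2',<_3'\}$ (which is a standard representation of $V'$). Then $\Sigma_2(R')$ equals the graph $H$ obtained from $\Sigma_2(R)$ by contracting the edge $a_1b$ and labelling the new vertex $a_1$; that is, $H$ has vertex set $V'$, and its edges are the edges of $\Sigma_2(R)$ not incident to $b$ together with the edges $a_1t$ for every neighbour $t\neq a_1$ of $b$ in $\Sigma_2(R)$.
   Context: Let $V$ be a finite set. A set $R=\{<_1,<_2,<_3\}$ of three linear orders on $V$ is a standard representation of $V$ if (i) for every $x\ne y$ in $V$ there exists $i\in\{1,2,3\}$ with $x<_i y$, and (ii) for each $i$, the maximum element $a_i$ of $<_i$ is among the two smallest elements of $<_j$ for each $j\neq i$. One writes $R=R(a_1,a_2,a_3)$ to indicate that $a_i$ is the maximum of $<_i$. The graph $\Sigma_2(R)$ has vertex set $V$, and a pair $xy$ of distinct vertices is an edge iff for every $z\in V\setminus\{x,y\}$ there is $i\in\{1,2,3\}$ with $z>_i x$ and $z>_i y$. (It is a fact that $a_1b$ is an edge of $\Sigma_2(R)$.) -}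

module Defs where

open import Data.Nat using (ℕ)
open import Data.Fin using (Fin; zero)
open import Data.Product using (_×_; ∃)
open import Data.Sum using (_⊎_)
open import Data.Unit using (⊤)
open import Relation.Binary.PropositionalEquality using (_≡_; _≢_)
open import Relation.Binary.Structures using (IsStrictTotalOrder)

-- The finite set V is modelled as Fin n.
-- A triple of strict orders on V, indexed by i ∈ Fin 3 (i = 0,1,2 ↔ <₁,<₂,<₃).
Orders : ℕ → Set₁
Orders n = Fin 3 → Fin n → Fin n → Set

IsMax : ∀ {n} → (Fin n → Fin n → Set) → Fin n → Set
IsMax {n} _<_ a = ∀ (z : Fin n) → z ≢ a → z < a

AmongTwoSmallest : ∀ {n} → (Fin n → Fin n → Set) → Fin n → Set
AmongTwoSmallest {n} _<_ a = ∀ (z w : Fin n) → z < a → w < a → z ≡ w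

record StandardRep {n : ℕ} (R : Orders n) (a : Fin 3 → Fin n) : Set where
  field
    linear : ∀ i → IsStrictTotalOrder _≡_ (R i)
    cover  : ∀ (x y : Fin n) → x ≢ y → ∃ λ i → R i x y
    isMax  : ∀ i → IsMax (R i) (a i)
    small  : ∀ i j → i ≢ j → AmongTwoSmallest (R j) (a i)

-- Edge relation of Σ₂ of the restriction of R to the vertex subset P ⊆ V.
-- (Restricting the orders to P and using them on P is the same as using R on P.)
Σ₂Edge : ∀ {n} → (Fin n → Set) → Orders n → Fin n → Fin n → Set
Σ₂Edge {n} P R x y =
  P x × P y × x ≢ y ×
  (∀ (z : Fin n) → P z → z ≢ x → z ≢ y → ∃ λ i → R i x z × R i y z)

Whole : ∀ {n} → Fin n → Set
Whole _ = ⊤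

Without : ∀ {n} → Fin n → Fin n → Set
Without b z = z ≢ b

IsMaxExcept : ∀ {n} → (Fin n → Fin n → Set) → Fin n → Fin n → Set
IsMaxExcept {n} _<_ a b = b ≢ a × (∀ (z : Fin n) → z ≢ a → z ≢ b → z < b)

HEdge : ∀ {n} → Orders n → Fin n → Fin n → Fin n → Fin n → Set
HEdge R a₁ b x y =
  x ≢ b × y ≢ b × x ≢ y ×
  (Σ₂Edge Whole R x y
   ⊎ (x ≡ a₁ × Σ₂Edge Whole R b y)
   ⊎ (y ≡ a₁ × Σ₂Edge Whole R b x))

module Submission where

open import Defs
open import Data.Nat using (ℕ; _≤_)
open import Data.Fin using (Fin; zero; suc; _≟_)
open import Data.Fin.Properties using (any?)
open import Data.Product using (_×_; _,_; ∃; proj₁; proj₂)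
open import Data.Sum using (_⊎_; inj₁; inj₂; [_,_])
open import Data.Unit using (tt)
open import Data.Empty using (⊥; ⊥-elim)
open import Function.Bundles using (_⇔_; mk⇔)
open import Relation.Nullary using (¬_; Dec; yes; no)
open import Relation.Nullary.Decidable using (_×-dec_)
open import Relation.Binary.PropositionalEquality using (_≡_; _≢_; refl; sym)
open import Relation.Binary.Structures using (IsStrictTotalOrder)
open import Relation.Binary.Definitions using (tri<; tri≈; tri>)

-- Contracting a₁b only matters for the edges a₁y: since b is <₁-above every
-- vertex other than a₁, it is a common upper bound for any other pair.  For a₁y,
-- either b already lies above a₁ and y in some order, so a₁y stays an edge when b
-- is added back, or it does not, and then b can replace a₁ in every witness, so
-- by is an edge.  Conversely, a witness for by is one for a₁y: a vertex z above b
-- but below a₁ in some order is impossible, in <₁ by the choice of b and in the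
-- other orders since a₁ is among their two smallest elements.

Above : ∀ {n} → Orders n → Fin n → Fin n → Fin n → Set
Above R x y z = ∃ λ i → R i x z × R i y z

module _ {n : ℕ} {R : Orders n} where

  Above-swap : ∀ {x y z} → Above R x y z → Above R y x z
  Above-swap (i , x<z , y<z) = i , y<z , x<z

  Σ₂Edge-sym : ∀ {P x y} → Σ₂Edge P R x y → Σ₂Edge P R y x
  Σ₂Edge-sym (Px , Py , x≢y , above) =
    Py , Px , (λ y≡x → x≢y (sym y≡x)) , λ z Pz z≢y z≢x → Above-swap (above z Pz z≢x z≢y)

  Σ₂Edge-restrict : ∀ {P Q : Fin n → Set} {x y} → (∀ {z} → Q z → P z) →
                    Q x → Q y → Σ₂Edge P R x y → Σ₂Edge Q R x y
  Σ₂Edge-restrict Q⊆P Qx Qy (_ , _ , x≢y , above) =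
    Qx , Qy , x≢y , λ z Qz → above z (Q⊆P Qz)

  Σ₂Edge-extend : ∀ {b x y} → Σ₂Edge (Without b) R x y → Above R x y b →
                  Σ₂Edge Whole R x y
  Σ₂Edge-extend {b} {x} {y} (_ , _ , x≢y , above) above-b =
    tt , tt , x≢y , witness
    where
    witness : ∀ z → Whole z → z ≢ x → z ≢ y → Above R x y z
    witness z _ with z ≟ b
    ... | yes refl = λ _ _ → above-b
    ... | no z≢b = above z z≢b

module _ {n : ℕ} {R : Orders n} (linear : ∀ i → IsStrictTotalOrder _≡_ (R i)) where
  private module O i = IsStrictTotalOrder (linear i)

  Above? : ∀ x y z → Dec (Above R x y z)
  Above? x y z = any? λ i → O._<?_ i x z ×-dec O._<?_ i y z

  Above-transfer : ∀ {x y z w} → Above R x y z → ¬ Above R x y w → z ≢ w →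
                   Above R w y z
  Above-transfer {z = z} {w} (i , x<z , y<z) ¬above-w z≢w with O.compare i w z
  ... | tri< w<z _ _ = i , w<z , y<z
  ... | tri≈ _ w≡z _ = ⊥-elim (z≢w (sym w≡z))
  ... | tri> _ _ z<w = ⊥-elim (¬above-w (i , O.trans i x<z z<w , O.trans i y<z z<w))

module Contraction {n : ℕ} {R : Orders n} {a : Fin 3 → Fin n} (SR : StandardRep R a)
                   {b : Fin n} (b-max : IsMaxExcept (R zero) (a zero) b) where
  open StandardRep SR
  private module O i = IsStrictTotalOrder (linear i)

  a₁ : Fin n
  a₁ = a zero

  b≢a₁ : b ≢ a₁
  b≢a₁ = proj₁ b-max

  below-b : ∀ {z} → z ≢ a₁ → z ≢ b → R zero z b
  below-b z≢a₁ z≢b = proj₂ b-max _ z≢a₁ z≢b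

  above-b⇒above-a₁ : ∀ i {z} → z ≢ a₁ → z ≢ b → R i b z → R i a₁ z
  above-b⇒above-a₁ i {z} z≢a₁ z≢b b<z with O.compare i a₁ z
  ... | tri< a₁<z _ _ = a₁<z
  ... | tri≈ _ a₁≡z _ = ⊥-elim (z≢a₁ (sym a₁≡z))
  ... | tri> _ _ z<a₁ = ⊥-elim (no-gap i b<z z<a₁)
    where
    no-gap : ∀ i → R i b z → R i z a₁ → ⊥
    no-gap zero    b<z _    = O.asym zero b<z (below-b z≢a₁ z≢b)
    no-gap (suc k) b<z z<a₁ =
      z≢b (sym (small zero (suc k) (λ ()) b z (O.trans (suc k) b<z z<a₁) z<a₁))

  Σ₂Edge-b⇒a₁ : ∀ {y} → a₁ ≢ y → y ≢ b → Σ₂Edge Whole R b y → Σ₂Edge (Without b) R a₁ y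
  Σ₂Edge-b⇒a₁ {y} a₁≢y y≢b (_ , _ , _ , above) =
    (λ a₁≡b → b≢a₁ (sym a₁≡b)) , y≢b , a₁≢y , witness
    where
    witness : ∀ z → z ≢ b → z ≢ a₁ → z ≢ y → Above R a₁ y z
    witness z z≢b z≢a₁ z≢y =
      let (i , b<z , y<z) = above z tt z≢b z≢y
      in i , above-b⇒above-a₁ i z≢a₁ z≢b b<z , y<z

  Σ₂Edge-a₁⇒ : ∀ {y} → Σ₂Edge (Without b) R a₁ y →
               Σ₂Edge Whole R a₁ y ⊎ Σ₂Edge Whole R b y
  Σ₂Edge-a₁⇒ {y} edge@(_ , y≢b , a₁≢y , above) with Above? linear a₁ y b
  ... | yes above-b = inj₁ (Σ₂Edge-extend edge above-b)
  ... | no ¬above-b = inj₂ (tt , tt , (λ b≡y → y≢b (sym b≡y)) , witness)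
    where
    witness : ∀ z → Whole z → z ≢ b → z ≢ y → Above R b y z
    witness z _ z≢b z≢y with z ≟ a₁
    ... | yes refl = zero , isMax zero b b≢a₁ , isMax zero y (λ y≡a₁ → a₁≢y (sym y≡a₁))
    ... | no z≢a₁  = Above-transfer linear (above z z≢b z≢a₁ z≢y) ¬above-b z≢b

  Σ₂Edge-off-a₁ : ∀ {x y} → x ≢ a₁ → y ≢ a₁ → Σ₂Edge (Without b) R x y →
                  Σ₂Edge Whole R x y
  Σ₂Edge-off-a₁ x≢a₁ y≢a₁ edge@(x≢b , y≢b , _) =
    Σ₂Edge-extend edge (zero , below-b x≢a₁ x≢b , below-b y≢a₁ y≢b)

  contract : ∀ x y → Σ₂Edge (Without b) R x y → HEdge R a₁ b x y
  contract x y edge@(x≢b , y≢b , x≢y , _) with x ≟ a₁ | y ≟ a₁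
  ... | yes refl | yes refl = ⊥-elim (x≢y refl)
  ... | yes refl | no _ = x≢b , y≢b , x≢y , [ inj₁ , (λ e → inj₂ (inj₁ (refl , e))) ]
                                             (Σ₂Edge-a₁⇒ edge)
  ... | no _ | yes refl = x≢b , y≢b , x≢y , [ (λ e → inj₁ (Σ₂Edge-sym e)) ,
                                              (λ e → inj₂ (inj₂ (refl , e))) ]
                                             (Σ₂Edge-a₁⇒ (Σ₂Edge-sym edge))
  ... | no x≢a₁ | no y≢a₁ = x≢b , y≢b , x≢y , inj₁ (Σ₂Edge-off-a₁ x≢a₁ y≢a₁ edge)

  expand : ∀ x y → HEdge R a₁ b x y → Σ₂Edge (Without b) R x y
  expand x y (x≢b , y≢b , _ , inj₁ edge) = Σ₂Edge-restrict (λ _ → tt) x≢b y≢b edge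
  expand x y (_ , y≢b , x≢y , inj₂ (inj₁ (refl , edge))) = Σ₂Edge-b⇒a₁ x≢y y≢b edge
  expand x y (x≢b , _ , x≢y , inj₂ (inj₂ (refl , edge))) =
    Σ₂Edge-sym (Σ₂Edge-b⇒a₁ (λ a₁≡x → x≢y (sym a₁≡x)) x≢b edge)

lemma3 : (n : ℕ) → 4 ≤ n → (R : Orders n) → (a : Fin 3 → Fin n) →
         StandardRep R a → (b : Fin n) → IsMaxExcept (R zero) (a zero) b →
         ∀ (x y : Fin n) → Σ₂Edge (Without b) R x y ⇔ HEdge R (a zero) b x y
lemma3 _ _ _ _ SR _ b-max x y = mk⇔ (contract x y) (expand x y)
  where open Contraction SR b-max
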